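{- Let $p>3$ be a prime. Then $$\sum_{k=0}^{\frac{p-1}{2}} (6k+1) \left(\frac{(\frac12)_k}{k!}\right)^3 \frac{(-1)^k}{8^k}\equiv (-1)^{\frac{p^2-1}{8}+\frac{p-1}{2}}p \pmod{p^2}.$$
   Context: For $a\in\mathbb{C}$ and $k\in\mathbb{N}$, $(a)_k=a(a+1)\cdots(a+k-1)$ denotes the rising factorial, with $(a)_0=1$. A congruence $A\equiv B \pmod{p^m}$ between rational numbers means that $A-B\in p^m\mathbb{Z}_{(p)}$. -}

module Defs where

open import Data.Nat as ℕ using (ℕ; zero; suc; _∸_; NonZero; _!)
open import Data.Nat.Properties as ℕP using (_!≢0; m^n≢0)
open import Data.Nat.Divisibility as ℕD using ()
open import Data.Integer as ℤ using (ℤ; +_)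
open import Data.Integer.Divisibility as ℤD using ()
open import Data.Rational as ℚ using (ℚ; _+_; _*_; _-_; 0ℚ; 1ℚ; ½; -_; ↥_; ↧ₙ_)
open import Data.Product using (_×_)
open import Relation.Nullary using (¬_)

rising : ℚ → ℕ → ℚ
rising a zero = 1ℚ
rising a (suc k) = rising a k * (a + (+ k ℚ./ 1))

sumTo : ℕ → (ℕ → ℚ) → ℚ
sumTo zero f = f 0
sumTo (suc n) f = sumTo n f + f (suc n)

pow : ℚ → ℕ → ℚ
pow q zero = 1ℚ
pow q (suc n) = pow q n * q

sgn : ℕ → ℚ
sgn n = pow (- 1ℚ) n

inv : (n : ℕ) → .{{NonZero n}} → ℚ
inv n = + 1 ℚ./ n

-- A ≡ B (mod p^m) for rationals: A - B ∈ p^m ℤ_(p), i.e. writing A - B in lowest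
-- terms, p does not divide the denominator and p^m divides the numerator.
_≡_[mod_^_] : ℚ → ℚ → ℕ → ℕ → Set
A ≡ B [mod p ^ m ] =
  (¬ (p ℕD.∣ ↧ₙ (A - B))) × ((+ (p ℕ.^ m)) ℤD.∣ ↥ (A - B))

summand : ℕ → ℚ
summand k =
  (+ (6 ℕ.* k ℕ.+ 1) ℚ./ 1)
  * pow (rising ½ k * inv (k !) {{k !≢0}}) 3
  * sgn k
  * inv (8 ℕ.^ k) {{m^n≢0 8 k}}

-- Write p = 2n + 1 and let ∏β n k be the product over j < k of
--   β n j = (2j+1)(n-j)(n+j+1) / ((j+1)(4j+3-2n)(4j+5+2n)).
-- Since (n-j)(n+j+1) = (p² - (2j+1)²)/4 and (4j+3-2n)(4j+5+2n) = 16(j+1)² - p², each β n j is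
-- congruent mod p² to -(2j+1)³/(64(j+1)³), the ratio of consecutive terms of ((1/2)_k/k!)³(-1/8)^k;
-- all factors involved are p-integral for k ≤ n, so the sum is congruent mod p² to
-- S n = Σ_{k ≤ n} (6k+1) ∏β n k. This truncated sum is evaluated exactly by a WZ pair (F, G):
-- F (n+2) k/(2n+5) + F n k/(2n+1) = G n (k+1) - G n k telescopes in k to
-- S (n+2)/(2n+5) = -S n/(2n+1), whence S n = (-1)^(n(n+3)/2) (2n+1), and
-- n(n+3)/2 = (p²-1)/8 + (p-1)/2.
module Submission where

open import Data.Nat as ℕ using (ℕ; zero; suc)
import Data.Nat.Properties as ℕP
import Data.Nat.Divisibility as ℕD
import Data.Nat.Tactic.RingSolver as ℕ-Solver
open import Data.Integer as ℤ using (ℤ; +_)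
import Data.Integer.Properties as ℤP
open import Data.Product using (_×_; _,_; proj₂)
open import Data.Sum using (inj₁; inj₂)
open import Relation.Nullary using (¬_; yes; no; contradiction)
open import Relation.Binary.PropositionalEquality

-- Stated over an arbitrary signature so that each polynomial exists both over ℤ and as a
-- ring-solver expression; the solver's normaliser then checks identities between them.
module Polynomials {A : Set} (const : ℕ → A) (add mul : A → A → A) (neg : A → A) where

  private
    infixl 6 _+_ _-_
    infixl 7 _*_
    infix  8 -_ #_

    #_ : ℕ → A
    #_ = const

    _+_ _*_ _-_ : A → A → A
    _+_ = add
    _*_ = mul
    x - y = x + neg y

    -_ : A → A
    -_ = neg

  odd : A → A
  odd n = # 2 * n + # 1

  βᵃ-num βᵇ-den β-num β-den : A → A → A
  βᵃ-num n k = (n - k) * (n + k + # 1)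
  βᵇ-den n k = odd (# 2 * k + # 1 - n) * odd (# 2 * k + # 2 + n)
  β-num  n k = odd k * βᵃ-num n k
  β-den  n k = (k + # 1) * βᵇ-den n k

  shiftᵃ-num shiftᵃ-den shiftᵇ-num shiftᵇ-den shift-num shift-den : A → A → A
  shiftᵃ-num n k = (n + k + # 1) * (n + k + # 2)
  shiftᵃ-den n k = (n + # 2 - k) * (n + # 1 - k)
  shiftᵇ-num n k = odd (n - # 2 * k) * odd (n + # 2)
  shiftᵇ-den n k = odd n * (# 4 * k + # 2 * n + # 5)
  shift-num  n k = shiftᵃ-num n k * shiftᵇ-num n k
  shift-den  n k = shiftᵃ-den n k * shiftᵇ-den n k

  cert-num cert-den : A → A → A
  cert-num n k = - (# 2 * k * (# 2 * n + # 3) * (# 4 * k + # 2 * n + # 5))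
  cert-den n k = odd (n + # 2) * shiftᵃ-num n k

  -- the four terms of the WZ equation, each multiplied by shift-num n k
  wz₁ wz₂ wz₃ wz₄ : A → A → A
  wz₁ n k = (# 6 * k + # 1) * shiftᵃ-num n k * odd (n - # 2 * k)
  wz₂ n k = # 2 * (# 2 * n + # 3) * odd k * (n + # 2 - k) * (n + k + # 1)
  wz₃ n k = cert-num n k * odd (n - # 2 * k)
  wz₄ n k = (# 6 * k + # 1) * shiftᵃ-den n k * (# 4 * k + # 2 * n + # 5)

  α-num α-den : A → A
  α-num k = - (odd k * odd k * odd k)
  α-den k = # 64 * ((k + # 1) * (k + # 1) * (k + # 1))

module Proof where

  open import Data.Nat using (_^_; _≤_; _<_; s≤s; z≤n; NonZero; _!)
  open ℕD using (_∣_; divides)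
  import Data.Nat.Coprimality as Coprimality
  open import Data.Nat.Primality using (Prime; euclidsLemma; prime⇒nonZero; prime⇒nonTrivial)
  import Data.Integer.Divisibility.Signed as ℤS
  import Data.Integer.Tactic.RingSolver as ℤ-Solver
  open import Data.Integer.Tactic.RingSolver using (solve-∀)
  open import Tactic.RingSolver.NonReflective ℤ-Solver.ring using (solve; _⊜_; Expr; Κ; _⊕_; _⊗_; ⊝_)
  open import Data.Rational as ℚ using (ℚ; mkℚ; _+_; _*_; _-_; -_; 0ℚ; 1ℚ; ½; ↥_; ↧_; ↧ₙ_; _/_; 1/_; toℚᵘ)
  import Data.Rational.Properties as ℚP
  import Data.Rational.Unnormalised as ℚᵘ
  import Data.Rational.Unnormalised.Properties as ℚᵘP
  import Tactic.RingSolver as ℚ-Solver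
  import Tactic.RingSolver.Core.AlmostCommutativeRing as ACR
  open import Defs using (sumTo; rising; pow; sgn; inv; summand)
  open import Algebra.Properties.Group ℚP.+-0-group using ()
    renaming (⁻¹-involutive to neg-involutive; inverseˡ-unique to +-inverseˡ-unique)
  open import Data.Nat.Properties using (_!≢0; m^n≢0)
  open import Data.Empty using (⊥-elim)
  open import Data.Maybe using (Maybe; just; nothing)
  open import Level using (0ℓ)

  ℚ-ring : ACR.AlmostCommutativeRing 0ℓ 0ℓ
  ℚ-ring = ACR.fromCommutativeRing ℚP.+-*-commutativeRing is-zero
    where
    is-zero : ∀ x → Maybe (0ℚ ≡ x)
    is-zero x with 0ℚ ℚP.≟ x
    ... | yes 0≡x = just 0≡x
    ... | no _    = nothing

  -- Integers and fractions inside ℚ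

  ι : ℤ → ℚ
  ι z = z / 1

  ι-toℚᵘ : ∀ z → toℚᵘ (ι z) ℚᵘ.≃ ℚᵘ.mkℚᵘ z 0
  ι-toℚᵘ z = ℚP.toℚᵘ-fromℚᵘ (ℚᵘ.mkℚᵘ z 0)

  ι-homo-+ : ∀ a b → ι (a ℤ.+ b) ≡ ι a + ι b
  ι-homo-+ a b = ℚP.toℚᵘ-injective (begin
    toℚᵘ (ι (a ℤ.+ b))                 ≈⟨ ι-toℚᵘ (a ℤ.+ b) ⟩
    ℚᵘ.mkℚᵘ (a ℤ.+ b) 0                ≈⟨ ℚᵘ.*≡* (cross a b) ⟩
    ℚᵘ.mkℚᵘ a 0 ℚᵘ.+ ℚᵘ.mkℚᵘ b 0       ≈⟨ ℚᵘP.+-cong (ι-toℚᵘ a) (ι-toℚᵘ b) ⟨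
    toℚᵘ (ι a) ℚᵘ.+ toℚᵘ (ι b)         ≈⟨ ℚP.toℚᵘ-homo-+ (ι a) (ι b) ⟨
    toℚᵘ (ι a + ι b)                   ∎)
    where
    open ℚᵘP.≃-Reasoning
    cross : ∀ a b → (a ℤ.+ b) ℤ.* + 1 ≡ (a ℤ.* + 1 ℤ.+ b ℤ.* + 1) ℤ.* + 1
    cross = solve-∀

  ι-homo-* : ∀ a b → ι (a ℤ.* b) ≡ ι a * ι b
  ι-homo-* a b = ℚP.toℚᵘ-injective (begin
    toℚᵘ (ι (a ℤ.* b))                 ≈⟨ ι-toℚᵘ (a ℤ.* b) ⟩
    ℚᵘ.mkℚᵘ (a ℤ.* b) 0                ≈⟨ ℚᵘP.*-cong (ι-toℚᵘ a) (ι-toℚᵘ b) ⟨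
    toℚᵘ (ι a) ℚᵘ.* toℚᵘ (ι b)         ≈⟨ ℚP.toℚᵘ-homo-* (ι a) (ι b) ⟨
    toℚᵘ (ι a * ι b)                   ∎)
    where open ℚᵘP.≃-Reasoning

  ι-homo‿- : ∀ a → ι (ℤ.- a) ≡ - ι a
  ι-homo‿- a = ℚP.toℚᵘ-injective (begin
    toℚᵘ (ι (ℤ.- a))        ≈⟨ ι-toℚᵘ (ℤ.- a) ⟩
    ℚᵘ.mkℚᵘ (ℤ.- a) 0       ≈⟨ ℚᵘP.-‿cong (ι-toℚᵘ a) ⟨
    ℚᵘ.- toℚᵘ (ι a)         ≈⟨ ℚP.toℚᵘ-homo‿- (ι a) ⟨
    toℚᵘ (- ι a)            ∎)
    where open ℚᵘP.≃-Reasoning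

  ι-injective : ∀ {a b} → ι a ≡ ι b → a ≡ b
  ι-injective {a} {b} eq
    with ℚᵘ.*≡* cross ← ℚᵘP.≃-trans (ℚᵘP.≃-sym (ι-toℚᵘ a)) (ℚᵘP.≃-trans (ℚP.toℚᵘ-cong eq) (ι-toℚᵘ b))
    = trans (sym (ℤP.*-identityʳ a)) (trans cross (ℤP.*-identityʳ b))

  ι-nonZero : ∀ {z} → z ≢ + 0 → ℚ.NonZero (ι z)
  ι-nonZero z≢0 = ℚ.≢-nonZero (λ ιz≡0 → z≢0 (ι-injective ιz≡0))

  -- junk value 0 at 0: every lemma about ι⁻¹ d assumes d ≢ 0
  ι⁻¹ : ℤ → ℚ
  ι⁻¹ z with z ℤP.≟ + 0
  ... | yes _   = 0ℚ
  ... | no z≢0  = 1/_ (ι z) {{ι-nonZero z≢0}}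

  ι⁻¹-inverseˡ : ∀ {z} → z ≢ + 0 → ι⁻¹ z * ι z ≡ 1ℚ
  ι⁻¹-inverseˡ {z} z≢0 with z ℤP.≟ + 0
  ... | yes z≡0  = ⊥-elim (z≢0 z≡0)
  ... | no z≢0′  = ℚP.*-inverseˡ (ι z) {{ι-nonZero z≢0′}}

  *-cancelʳ-ι : ∀ {x y d} → d ≢ + 0 → x * ι d ≡ y * ι d → x ≡ y
  *-cancelʳ-ι {x} {y} {d} d≢0 eq = begin
    x                      ≡⟨ reassoc x ⟩
    (x * ι d) * ι⁻¹ d      ≡⟨ cong (_* ι⁻¹ d) eq ⟩
    (y * ι d) * ι⁻¹ d      ≡⟨ reassoc y ⟨
    y                      ∎
    where
    open ≡-Reasoning
    reassoc : ∀ u → u ≡ (u * ι d) * ι⁻¹ d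
    reassoc u = begin
      u                      ≡⟨ ℚP.*-identityʳ u ⟨
      u * 1ℚ                 ≡⟨ cong (u *_) (ι⁻¹-inverseˡ d≢0) ⟨
      u * (ι⁻¹ d * ι d)      ≡⟨ cong (u *_) (ℚP.*-comm (ι⁻¹ d) (ι d)) ⟩
      u * (ι d * ι⁻¹ d)      ≡⟨ ℚP.*-assoc u (ι d) (ι⁻¹ d) ⟨
      (u * ι d) * ι⁻¹ d      ∎

  *-≢0 : ∀ {a b} → a ≢ + 0 → b ≢ + 0 → a ℤ.* b ≢ + 0
  *-≢0 {a} a≢0 b≢0 ab≡0 with ℤP.i*j≡0⇒i≡0∨j≡0 a ab≡0
  ... | inj₁ a≡0 = a≢0 a≡0
  ... | inj₂ b≡0 = b≢0 b≡0

  record Fraction (q : ℚ) : Set where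
    constructor fraction
    field
      num den : ℤ
      den≢0   : den ≢ + 0
      cleared : q * ι den ≡ ι num
  open Fraction public

  _÷_ : ℤ → ℤ → ℚ
  n ÷ d = ι n * ι⁻¹ d

  fraction-ι : ∀ z → Fraction (ι z)
  fraction-ι z = fraction z (+ 1) (λ ()) (ℚP.*-identityʳ (ι z))

  fraction-÷ : ∀ n {d} → d ≢ + 0 → Fraction (n ÷ d)
  fraction-÷ n {d} d≢0 = fraction n d d≢0 (begin
    ι n * ι⁻¹ d * ι d        ≡⟨ ℚP.*-assoc (ι n) (ι⁻¹ d) (ι d) ⟩
    ι n * (ι⁻¹ d * ι d)      ≡⟨ cong (ι n *_) (ι⁻¹-inverseˡ d≢0) ⟩
    ι n * 1ℚ                 ≡⟨ ℚP.*-identityʳ (ι n) ⟩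
    ι n                      ∎)
    where open ≡-Reasoning

  ↧-cleared : ∀ q → q * ι (↧ q) ≡ ι (↥ q)
  ↧-cleared q@(mkℚ n d-1 _) = ℚP.toℚᵘ-injective (begin
    toℚᵘ (q * ι (↧ q))                      ≈⟨ ℚP.toℚᵘ-homo-* q (ι (↧ q)) ⟩
    ℚᵘ.mkℚᵘ n d-1 ℚᵘ.* toℚᵘ (ι (↧ q))        ≈⟨ ℚᵘP.*-congˡ {ℚᵘ.mkℚᵘ n d-1} (ι-toℚᵘ (↧ q)) ⟩
    ℚᵘ.mkℚᵘ n d-1 ℚᵘ.* ℚᵘ.mkℚᵘ (↧ q) 0      ≈⟨ ℚᵘ.*≡* (cross n (↧ q)) ⟩
    ℚᵘ.mkℚᵘ n 0                             ≈⟨ ι-toℚᵘ n ⟨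
    toℚᵘ (ι n)                              ∎)
    where
    open ℚᵘP.≃-Reasoning
    cross : ∀ n D → n ℤ.* D ℤ.* + 1 ≡ n ℤ.* (D ℤ.* + 1)
    cross = solve-∀

  fraction-canonical : ∀ q → Fraction q
  fraction-canonical q = fraction (↥ q) (↧ q) (λ ()) (↧-cleared q)

  module _ {x y : ℚ} (f : Fraction x) (g : Fraction y) where

    private
      mul-solve : ∀ x y a b → (x * y) * (a * b) ≡ (x * a) * (y * b)
      mul-solve = ℚ-Solver.solve-∀ ℚ-ring
      add-solve : ∀ x y a b → (x + y) * (a * b) ≡ (x * a) * b + (y * b) * a
      add-solve = ℚ-Solver.solve-∀ ℚ-ring

    fraction-* : Fraction (x * y)
    fraction-* = fraction (num f ℤ.* num g) (den f ℤ.* den g) (*-≢0 (den≢0 f) (den≢0 g)) (begin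
      (x * y) * ι (den f ℤ.* den g)          ≡⟨ cong ((x * y) *_) (ι-homo-* (den f) (den g)) ⟩
      (x * y) * (ι (den f) * ι (den g))      ≡⟨ mul-solve x y (ι (den f)) (ι (den g)) ⟩
      (x * ι (den f)) * (y * ι (den g))      ≡⟨ cong₂ _*_ (cleared f) (cleared g) ⟩
      ι (num f) * ι (num g)                  ≡⟨ ι-homo-* (num f) (num g) ⟨
      ι (num f ℤ.* num g)                    ∎)
      where open ≡-Reasoning

    fraction-+ : Fraction (x + y)
    fraction-+ = fraction (num f ℤ.* den g ℤ.+ num g ℤ.* den f) (den f ℤ.* den g) (*-≢0 (den≢0 f) (den≢0 g)) (begin
      (x + y) * ι (den f ℤ.* den g)                          ≡⟨ cong ((x + y) *_) (ι-homo-* (den f) (den g)) ⟩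
      (x + y) * (ι (den f) * ι (den g))                      ≡⟨ add-solve x y (ι (den f)) (ι (den g)) ⟩
      (x * ι (den f)) * ι (den g) + (y * ι (den g)) * ι (den f)
                                                             ≡⟨ cong₂ (λ u v → u * ι (den g) + v * ι (den f)) (cleared f) (cleared g) ⟩
      ι (num f) * ι (den g) + ι (num g) * ι (den f)          ≡⟨ cong₂ _+_ (ι-homo-* (num f) (den g)) (ι-homo-* (num g) (den f)) ⟨
      ι (num f ℤ.* den g) + ι (num g ℤ.* den f)              ≡⟨ ι-homo-+ (num f ℤ.* den g) (num g ℤ.* den f) ⟨
      ι (num f ℤ.* den g ℤ.+ num g ℤ.* den f)                ∎)
      where open ≡-Reasoning

  fraction-‿- : ∀ {x} → Fraction x → Fraction (- x)
  fraction-‿- {x} f = fraction (ℤ.- num f) (den f) (den≢0 f) (begin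
    (- x) * ι (den f)        ≡⟨ ℚP.neg-distribˡ-* x (ι (den f)) ⟨
    - (x * ι (den f))        ≡⟨ cong -_ (cleared f) ⟩
    - ι (num f)              ≡⟨ ι-homo‿- (num f) ⟨
    ι (ℤ.- num f)            ∎)
    where open ≡-Reasoning

  fraction-- : ∀ {x y} → Fraction x → Fraction y → Fraction (x - y)
  fraction-- f g = fraction-+ f (fraction-‿- g)

  cleared-* : ∀ {x} (f : Fraction x) e → x * ι (den f ℤ.* e) ≡ ι (num f ℤ.* e)
  cleared-* {x} f e = begin
    x * ι (den f ℤ.* e)          ≡⟨ cong (x *_) (ι-homo-* (den f) e) ⟩
    x * (ι (den f) * ι e)        ≡⟨ ℚP.*-assoc x (ι (den f)) (ι e) ⟨
    x * ι (den f) * ι e          ≡⟨ cong (_* ι e) (cleared f) ⟩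
    ι (num f) * ι e              ≡⟨ ι-homo-* (num f) e ⟨
    ι (num f ℤ.* e)              ∎
    where open ≡-Reasoning

  fraction-cross : ∀ {x} (f g : Fraction x) → num f ℤ.* den g ≡ num g ℤ.* den f
  fraction-cross {x} f g = ι-injective (begin
    ι (num f ℤ.* den g)          ≡⟨ cleared-* f (den g) ⟨
    x * ι (den f ℤ.* den g)      ≡⟨ cong (λ e → x * ι e) (ℤP.*-comm (den f) (den g)) ⟩
    x * ι (den g ℤ.* den f)      ≡⟨ cleared-* g (den f) ⟩
    ι (num g ℤ.* den f)          ∎)
    where open ≡-Reasoning

  fraction-≡ : ∀ {x y} (f : Fraction x) (g : Fraction y) → num f ℤ.* den g ≡ num g ℤ.* den f → x ≡ y
  fraction-≡ {x} {y} f g cross = *-cancelʳ-ι (*-≢0 (den≢0 f) (den≢0 g)) (begin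
    x * ι (den f ℤ.* den g)      ≡⟨ cleared-* f (den g) ⟩
    ι (num f ℤ.* den g)          ≡⟨ cong ι cross ⟩
    ι (num g ℤ.* den f)          ≡⟨ cleared-* g (den f) ⟨
    y * ι (den g ℤ.* den f)      ≡⟨ cong (λ e → y * ι e) (ℤP.*-comm (den g) (den f)) ⟩
    y * ι (den f ℤ.* den g)      ∎)
    where open ≡-Reasoning

  fraction-≡ι : ∀ {x} (f : Fraction x) z → num f ≡ z ℤ.* den f → x ≡ ι z
  fraction-≡ι f z eq = fraction-≡ f (fraction-ι z) (trans (ℤP.*-identityʳ (num f)) eq)

  -- Finite sums

  sumTo-+ : ∀ m (f g : ℕ → ℚ) → sumTo m (λ k → f k + g k) ≡ sumTo m f + sumTo m g
  sumTo-+ zero    f g = refl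
  sumTo-+ (suc m) f g = trans (cong (_+ (f (suc m) + g (suc m))) (sumTo-+ m f g))
                              (interchange (sumTo m f) (sumTo m g) (f (suc m)) (g (suc m)))
    where
    interchange : ∀ a b c d → (a + b) + (c + d) ≡ (a + c) + (b + d)
    interchange = ℚ-Solver.solve-∀ ℚ-ring

  sumTo-*ʳ : ∀ m (f : ℕ → ℚ) c → sumTo m (λ k → f k * c) ≡ sumTo m f * c
  sumTo-*ʳ zero    f c = refl
  sumTo-*ʳ (suc m) f c = trans (cong (_+ f (suc m) * c) (sumTo-*ʳ m f c))
                               (sym (ℚP.*-distribʳ-+ c (sumTo m f) (f (suc m))))

  sumTo-telescope : ∀ {h g : ℕ → ℚ} → (∀ k → h k ≡ g (suc k) - g k) → ∀ m → sumTo m h ≡ g (suc m) - g 0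
  sumTo-telescope {h} {g} step zero    = step 0
  sumTo-telescope {h} {g} step (suc m) =
    trans (cong₂ _+_ (sumTo-telescope {h} {g} step m) (step (suc m)))
          (collapse (g (suc (suc m))) (g (suc m)) (g 0))
    where
    collapse : ∀ a b c → (b - c) + (a - b) ≡ a - c
    collapse = ℚ-Solver.solve-∀ ℚ-ring

  sumTo-- : ∀ m (f g : ℕ → ℚ) → sumTo m (λ k → f k - g k) ≡ sumTo m f - sumTo m g
  sumTo-- zero    f g = refl
  sumTo-- (suc m) f g = trans (cong (_+ (f (suc m) - g (suc m))) (sumTo-- m f g))
                              (interchange (sumTo m f) (sumTo m g) (f (suc m)) (g (suc m)))
    where
    interchange : ∀ a b c d → (a - b) + (c - d) ≡ (a + c) - (b + d)
    interchange = ℚ-Solver.solve-∀ ℚ-ring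

  -- Divisibility by powers of p in ℤ₍ₚ₎

  record _^_∣ℚ_ (p m : ℕ) (q : ℚ) : Set where
    constructor ∣ℚ⟨_,_⟩
    field
      den-coprime   : ¬ (p ∣ ↧ₙ q)
      num-divisible : p ^ m ∣ ℤ.∣ ↥ q ∣
  open _^_∣ℚ_ public

  module _ {p : ℕ} (p-prime : Prime p) where

    private instance
      p≢0 : ℕ.NonZero p
      p≢0 = prime⇒nonZero p-prime

    ∤-* : ∀ {a b} → ¬ (p ∣ a) → ¬ (p ∣ b) → ¬ (p ∣ a ℕ.* b)
    ∤-* {a} {b} p∤a p∤b p∣ab with euclidsLemma a b p-prime p∣ab
    ... | inj₁ p∣a = p∤a p∣a
    ... | inj₂ p∣b = p∤b p∣b

    ∤-abs-* : ∀ a b → ¬ (p ∣ ℤ.∣ a ∣) → ¬ (p ∣ ℤ.∣ b ∣) → ¬ (p ∣ ℤ.∣ a ℤ.* b ∣)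
    ∤-abs-* a b p∤a p∤b rewrite ℤP.abs-* a b = ∤-* p∤a p∤b

    ∤-1 : ¬ (p ∣ 1)
    ∤-1 p∣1 = ℕ.nonTrivial⇒≢1 {{prime⇒nonTrivial p-prime}} (ℕD.∣1⇒≡1 p∣1)

    ^∣-cancelʳ : ∀ m {a b} → ¬ (p ∣ b) → p ^ m ∣ a ℕ.* b → p ^ m ∣ a
    ^∣-cancelʳ zero    {a}     p∤b _ = ℕD.1∣ a
    ^∣-cancelʳ (suc m) {a} {b} p∤b pᵐ⁺¹∣ab with euclidsLemma a b p-prime (ℕD.∣-trans (ℕD.m∣m*n (p ^ m)) pᵐ⁺¹∣ab)
    ... | inj₂ p∣b = contradiction p∣b p∤b
    ... | inj₁ (divides a′ refl) = subst (p ^ suc m ∣_) (ℕP.*-comm p a′)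
      (ℕD.*-monoʳ-∣ p (^∣-cancelʳ m p∤b (ℕD.*-cancelˡ-∣ p (subst (p ^ suc m ∣_) reassoc pᵐ⁺¹∣ab))))
      where
      reassoc : a′ ℕ.* p ℕ.* b ≡ p ℕ.* (a′ ℕ.* b)
      reassoc = trans (cong (ℕ._* b) (ℕP.*-comm a′ p)) (ℕP.*-assoc p a′ b)

    ∣ℚ-fraction : ∀ {q} m (f : Fraction q) → ¬ (p ∣ ℤ.∣ den f ∣) → p ^ m ∣ ℤ.∣ num f ∣ → p ^ m ∣ℚ q
    ∣ℚ-fraction {q@(mkℚ n d-1 n⊥d)} m f p∤D pᵐ∣N = ∣ℚ⟨ p∤d , pᵐ∣n ⟩
      where
      abs-cross : ℤ.∣ n ∣ ℕ.* ℤ.∣ den f ∣ ≡ ℤ.∣ num f ∣ ℕ.* suc d-1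
      abs-cross = begin
        ℤ.∣ n ∣ ℕ.* ℤ.∣ den f ∣      ≡⟨ ℤP.abs-* n (den f) ⟨
        ℤ.∣ n ℤ.* den f ∣            ≡⟨ cong ℤ.∣_∣ (fraction-cross (fraction-canonical q) f) ⟩
        ℤ.∣ num f ℤ.* ↧ q ∣          ≡⟨ ℤP.abs-* (num f) (↧ q) ⟩
        ℤ.∣ num f ∣ ℕ.* suc d-1      ∎
        where open ≡-Reasoning
      p∤d : ¬ (p ∣ suc d-1)
      p∤d p∣d = p∤D (ℕD.∣-trans p∣d
        (Coprimality.coprime-divisor (Coprimality.sym (Coprimality.recompute n⊥d)) (divides ℤ.∣ num f ∣ abs-cross)))
      pᵐ∣n : p ^ m ∣ ℤ.∣ n ∣
      pᵐ∣n = ^∣-cancelʳ m p∤D (subst (p ^ m ∣_) (sym abs-cross) (ℕD.∣-trans pᵐ∣N (ℕD.m∣m*n (suc d-1))))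

    private
      ↥-divisible : ∀ {m} q → p ^ m ∣ℚ q → + (p ^ m) ℤS.∣ ↥ q
      ↥-divisible {m} q ∣ℚ⟨ _ , pᵐ∣q ⟩ = ℤS.∣ᵤ⇒∣ {+ (p ^ m)} {↥ q} pᵐ∣q

    ∣ℚ-+ : ∀ {m x y} → p ^ m ∣ℚ x → p ^ m ∣ℚ y → p ^ m ∣ℚ (x + y)
    ∣ℚ-+ {m} {x} {y} pᵐ∣x@(∣ℚ⟨ p∤x , _ ⟩) pᵐ∣y@(∣ℚ⟨ p∤y , _ ⟩) =
      ∣ℚ-fraction m (fraction-+ (fraction-canonical x) (fraction-canonical y)) (∤-abs-* (↧ x) (↧ y) p∤x p∤y)
        (ℤS.∣⇒∣ᵤ (ℤS.∣m∣n⇒∣m+n (ℤS.∣m⇒∣m*n (↧ y) (↥-divisible {m} x pᵐ∣x))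
                                (ℤS.∣m⇒∣m*n (↧ x) (↥-divisible {m} y pᵐ∣y))))

    ∣ℚ-* : ∀ {a b x y} → p ^ a ∣ℚ x → p ^ b ∣ℚ y → p ^ (a ℕ.+ b) ∣ℚ (x * y)
    ∣ℚ-* {a} {b} {x} {y} ∣ℚ⟨ p∤x , pᵃ∣x ⟩ ∣ℚ⟨ p∤y , pᵇ∣y ⟩ =
      ∣ℚ-fraction (a ℕ.+ b) (fraction-* (fraction-canonical x) (fraction-canonical y)) (∤-abs-* (↧ x) (↧ y) p∤x p∤y)
        (subst₂ _∣_ (sym (ℕP.^-distribˡ-+-* p a b)) (sym (ℤP.abs-* (↥ x) (↥ y))) (ℕD.*-pres-∣ pᵃ∣x pᵇ∣y))

    ∣ℚ-0ℚ : ∀ {m} → p ^ m ∣ℚ 0ℚ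
    ∣ℚ-0ℚ {m} = ∣ℚ⟨ ∤-1 , (p ^ m) ℕD.∣0 ⟩

    ∣ℚ-÷ : ∀ n {d} (d≢0 : d ≢ + 0) → ¬ (p ∣ ℤ.∣ d ∣) → p ^ 0 ∣ℚ (n ÷ d)
    ∣ℚ-÷ n d≢0 p∤d = ∣ℚ-fraction 0 (fraction-÷ n d≢0) p∤d (ℕD.1∣ _)

    ∣ℚ-ι : ∀ z → p ^ 0 ∣ℚ ι z
    ∣ℚ-ι z = ∣ℚ-fraction 0 (fraction-ι z) ∤-1 (ℕD.1∣ _)

    ∣ℚ-sumTo : ∀ {e} m (f : ℕ → ℚ) → (∀ k → k ≤ m → p ^ e ∣ℚ f k) → p ^ e ∣ℚ sumTo m f
    ∣ℚ-sumTo zero    f pᵉ∣f = pᵉ∣f 0 z≤n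
    ∣ℚ-sumTo (suc m) f pᵉ∣f =
      ∣ℚ-+ (∣ℚ-sumTo m f (λ k k≤m → pᵉ∣f k (ℕP.m≤n⇒m≤1+n k≤m))) (pᵉ∣f (suc m) ℕP.≤-refl)

  -- The WZ pair and the exact value of S n

  open Polynomials +_ ℤ._+_ ℤ._*_ ℤ.-_

  κ : ∀ {m} → ℕ → Expr ℤ m
  κ c = Κ (+ c)

  module E {m : ℕ} = Polynomials {Expr ℤ m} κ _⊕_ _⊗_ ⊝_

  odd-≢0 : ∀ z → odd z ≢ + 0
  odd-≢0 z odd≡0 = 2≢1 (ℕD.∣1⇒≡1 (ℤS.∣⇒∣ᵤ {+ 2} {+ 1} (ℤS.divides (ℤ.- z) (begin
    + 1                            ≡⟨ one≡ z ⟩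
    (ℤ.- z) ℤ.* + 2 ℤ.+ odd z      ≡⟨ cong (λ w → (ℤ.- z) ℤ.* + 2 ℤ.+ w) odd≡0 ⟩
    (ℤ.- z) ℤ.* + 2 ℤ.+ + 0        ≡⟨ ℤP.+-identityʳ _ ⟩
    (ℤ.- z) ℤ.* + 2                ∎))))
    where
    open ≡-Reasoning
    2≢1 : 2 ≢ 1
    2≢1 ()
    one≡ : ∀ z → + 1 ≡ (ℤ.- z) ℤ.* + 2 ℤ.+ odd z
    one≡ = solve 1 (λ z → κ 1 ⊜ ((⊝ z) ⊗ κ 2 ⊕ E.odd z)) refl

  +[m+suc]≢0 : ∀ m n → + (m ℕ.+ suc n) ≢ + 0
  +[m+suc]≢0 m n eq = ℕP.m+1+n≢0 m (ℤP.+-injective eq)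

  β-den-≢0 : ∀ n k → β-den (+ n) (+ k) ≢ + 0
  β-den-≢0 n k = *-≢0 (+[m+suc]≢0 k 0)
    (*-≢0 (odd-≢0 (+ 2 ℤ.* + k ℤ.+ + 1 ℤ.- + n)) (odd-≢0 (+ 2 ℤ.* + k ℤ.+ + 2 ℤ.+ + n)))

  shift-num-≢0 : ∀ n k → shift-num (+ n) (+ k) ≢ + 0
  shift-num-≢0 n k = *-≢0 (*-≢0 (+[m+suc]≢0 (n ℕ.+ k) 0) (+[m+suc]≢0 (n ℕ.+ k) 1))
    (*-≢0 (odd-≢0 (+ n ℤ.- + 2 ℤ.* + k)) (odd-≢0 (+ n ℤ.+ + 2)))

  cert-den-≢0 : ∀ n k → cert-den (+ n) (+ k) ≢ + 0
  cert-den-≢0 n k = *-≢0 (odd-≢0 (+ n ℤ.+ + 2)) (*-≢0 (+[m+suc]≢0 (n ℕ.+ k) 0) (+[m+suc]≢0 (n ℕ.+ k) 1))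

  α-den-≢0 : ∀ k → α-den (+ k) ≢ + 0
  α-den-≢0 k = *-≢0 {+ 64} (λ ()) (*-≢0 (*-≢0 k+1≢0 k+1≢0) k+1≢0)
    where
    k+1≢0 : + k ℤ.+ + 1 ≢ + 0
    k+1≢0 = +[m+suc]≢0 k 0

  shiftᵃ-step : ∀ n k → shiftᵃ-den n (k ℤ.+ + 1) ℤ.* βᵃ-num (n ℤ.+ + 2) k ℤ.* shiftᵃ-num n k
                      ≡ shiftᵃ-num n (k ℤ.+ + 1) ℤ.* βᵃ-num n k ℤ.* shiftᵃ-den n k
  shiftᵃ-step = solve 2 (λ n k → E.shiftᵃ-den n (k ⊕ κ 1) ⊗ E.βᵃ-num (n ⊕ κ 2) k ⊗ E.shiftᵃ-num n k
                               ⊜ E.shiftᵃ-num n (k ⊕ κ 1) ⊗ E.βᵃ-num n k ⊗ E.shiftᵃ-den n k) refl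

  shiftᵇ-step : ∀ n k → shiftᵇ-den n (k ℤ.+ + 1) ℤ.* βᵇ-den n k ℤ.* shiftᵇ-num n k
                      ≡ shiftᵇ-num n (k ℤ.+ + 1) ℤ.* βᵇ-den (n ℤ.+ + 2) k ℤ.* shiftᵇ-den n k
  shiftᵇ-step = solve 2 (λ n k → E.shiftᵇ-den n (k ⊕ κ 1) ⊗ E.βᵇ-den n k ⊗ E.shiftᵇ-num n k
                               ⊜ E.shiftᵇ-num n (k ⊕ κ 1) ⊗ E.βᵇ-den (n ⊕ κ 2) k ⊗ E.shiftᵇ-den n k) refl

  -- Both sides are products of the same linear factors, so the identity splits into the two above.
  shift-cross : ∀ n k →
    (shift-den n (k ℤ.+ + 1) ℤ.* β-num (n ℤ.+ + 2) k ℤ.* shift-num n k) ℤ.* (+ 1 ℤ.* β-den n k ℤ.* + 1)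
    ≡ (shift-num n (k ℤ.+ + 1) ℤ.* β-num n k ℤ.* shift-den n k) ℤ.* (+ 1 ℤ.* β-den (n ℤ.+ + 2) k ℤ.* + 1)
  shift-cross n k = begin
    _  ≡⟨ regroup (shiftᵃ-den n k′) (shiftᵇ-den n k′) (odd k) (βᵃ-num (n ℤ.+ + 2) k)
                  (shiftᵃ-num n k) (shiftᵇ-num n k) (k ℤ.+ + 1) (βᵇ-den n k) ⟩
    _  ≡⟨ cong₂ (λ x y → x ℤ.* y ℤ.* (odd k ℤ.* (k ℤ.+ + 1))) (shiftᵃ-step n k) (shiftᵇ-step n k) ⟩
    _  ≡⟨ regroup (shiftᵃ-num n k′) (shiftᵇ-num n k′) (odd k) (βᵃ-num n k)
                  (shiftᵃ-den n k) (shiftᵇ-den n k) (k ℤ.+ + 1) (βᵇ-den (n ℤ.+ + 2) k) ⟨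
    _  ∎
    where
    open ≡-Reasoning
    k′ = k ℤ.+ + 1
    regroup : ∀ sᵃ sᵇ o b tᵃ tᵇ e c →
      ((sᵃ ℤ.* sᵇ) ℤ.* (o ℤ.* b) ℤ.* (tᵃ ℤ.* tᵇ)) ℤ.* (+ 1 ℤ.* (e ℤ.* c) ℤ.* + 1)
      ≡ (sᵃ ℤ.* b ℤ.* tᵃ) ℤ.* (sᵇ ℤ.* c ℤ.* tᵇ) ℤ.* (o ℤ.* e)
    regroup = solve-∀

  β : ℕ → ℕ → ℚ
  β n k = β-num (+ n) (+ k) ÷ β-den (+ n) (+ k)

  ∏β : ℕ → ℕ → ℚ
  ∏β n zero    = 1ℚ
  ∏β n (suc k) = ∏β n k * β n k

  +suc : ∀ k → + suc k ≡ + k ℤ.+ + 1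
  +suc k = cong +_ (ℕP.+-comm 1 k)

  β-shift : ∀ n k →
    ι (shift-den (+ n) (+ k ℤ.+ + 1)) * β (n ℕ.+ 2) k * ι (shift-num (+ n) (+ k))
    ≡ ι (shift-num (+ n) (+ k ℤ.+ + 1)) * β n k * ι (shift-den (+ n) (+ k))
  β-shift n k = fraction-≡
    (fraction-* (fraction-* (fraction-ι (c₁ K′)) (fraction-÷ (β-num N₂ K) (β-den-≢0 (n ℕ.+ 2) k))) (fraction-ι (c₂ K)))
    (fraction-* (fraction-* (fraction-ι (c₂ K′)) (fraction-÷ (β-num N K) (β-den-≢0 n k))) (fraction-ι (c₁ K)))
    (shift-cross N K)
    where
    N = + n
    N₂ = + (n ℕ.+ 2)
    K = + k
    K′ = K ℤ.+ + 1
    c₁ = shift-den N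
    c₂ = shift-num N

  ∏β-shift : ∀ n k → ι (shift-den (+ n) (+ k)) * ∏β (n ℕ.+ 2) k ≡ ι (shift-num (+ n) (+ k)) * ∏β n k
  ∏β-shift n zero = cong (λ z → ι z * 1ℚ) (shift-at-0 (+ n))
    where
    shift-at-0 : ∀ n → shift-den n (+ 0) ≡ shift-num n (+ 0)
    shift-at-0 = solve 1 (λ n → E.shift-den n (κ 0) ⊜ E.shift-num n (κ 0)) refl
  ∏β-shift n (suc k) = begin
    ι (c₁ (+ suc k)) * (∏β n₂ k * β n₂ k)     ≡⟨ cong (λ z → ι (c₁ z) * (∏β n₂ k * β n₂ k)) (+suc k) ⟩
    ι c₁′ * (∏β n₂ k * β n₂ k)                ≡⟨ *-cancelʳ-ι (shift-num-≢0 n k) (begin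
        ι c₁′ * (∏β n₂ k * β n₂ k) * ι (c₂ K)          ≡⟨ regroup₁ (ι c₁′) (∏β n₂ k) (β n₂ k) (ι (c₂ K)) ⟩
        (ι c₁′ * β n₂ k * ι (c₂ K)) * ∏β n₂ k          ≡⟨ cong (_* ∏β n₂ k) (β-shift n k) ⟩
        (ι c₂′ * β n k * ι (c₁ K)) * ∏β n₂ k           ≡⟨ regroup₂ (ι c₂′ * β n k) (ι (c₁ K)) (∏β n₂ k) ⟩
        (ι c₂′ * β n k) * (ι (c₁ K) * ∏β n₂ k)         ≡⟨ cong ((ι c₂′ * β n k) *_) (∏β-shift n k) ⟩
        (ι c₂′ * β n k) * (ι (c₂ K) * ∏β n k)          ≡⟨ regroup₃ (ι c₂′) (β n k) (ι (c₂ K)) (∏β n k) ⟩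
        ι c₂′ * (∏β n k * β n k) * ι (c₂ K)            ∎) ⟩
    ι c₂′ * (∏β n k * β n k)                  ≡⟨ cong (λ z → ι (c₂ z) * (∏β n k * β n k)) (+suc k) ⟨
    ι (c₂ (+ suc k)) * (∏β n k * β n k)       ∎
    where
    open ≡-Reasoning
    n₂ = n ℕ.+ 2
    K = + k
    c₁ = shift-den (+ n)
    c₂ = shift-num (+ n)
    c₁′ = c₁ (K ℤ.+ + 1)
    c₂′ = c₂ (K ℤ.+ + 1)
    regroup₁ : ∀ a d b c → a * (d * b) * c ≡ (a * b * c) * d
    regroup₁ = ℚ-Solver.solve-∀ ℚ-ring
    regroup₂ : ∀ a b c → a * b * c ≡ a * (b * c)
    regroup₂ = ℚ-Solver.solve-∀ ℚ-ring
    regroup₃ : ∀ a b c d → (a * b) * (c * d) ≡ a * (d * b) * c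
    regroup₃ = ℚ-Solver.solve-∀ ℚ-ring

  F G : ℕ → ℕ → ℚ
  F n k = ι (+ 6 ℤ.* + k ℤ.+ + 1) * ∏β n k
  G n k = (cert-num (+ n) (+ k) ÷ cert-den (+ n) (+ k)) * ∏β (n ℕ.+ 2) k

  wz₁-cleared : ∀ n k → ((+ 6 ℤ.* k ℤ.+ + 1) ℤ.* + 1) ℤ.* shift-num n k ≡ wz₁ n k ℤ.* ((+ 1 ℤ.* odd (n ℤ.+ + 2)) ℤ.* + 1)
  wz₁-cleared = solve 2 (λ n k → (κ 6 ⊗ k ⊕ κ 1) ⊗ κ 1 ⊗ E.shift-num n k
                               ⊜ E.wz₁ n k ⊗ (κ 1 ⊗ E.odd (n ⊕ κ 2) ⊗ κ 1)) refl

  wz₂-cleared : ∀ n k → (cert-num n (k ℤ.+ + 1) ℤ.* β-num (n ℤ.+ + 2) k) ℤ.* shift-num n k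
                      ≡ wz₂ n k ℤ.* ((cert-den n (k ℤ.+ + 1) ℤ.* β-den (n ℤ.+ + 2) k) ℤ.* + 1)
  wz₂-cleared = solve 2 (λ n k → E.cert-num n (k ⊕ κ 1) ⊗ E.β-num (n ⊕ κ 2) k ⊗ E.shift-num n k
                               ⊜ E.wz₂ n k ⊗ (E.cert-den n (k ⊕ κ 1) ⊗ E.β-den (n ⊕ κ 2) k ⊗ κ 1)) refl

  wz₃-cleared : ∀ n k → cert-num n k ℤ.* shift-num n k ≡ wz₃ n k ℤ.* (cert-den n k ℤ.* + 1)
  wz₃-cleared = solve 2 (λ n k → E.cert-num n k ⊗ E.shift-num n k ⊜ E.wz₃ n k ⊗ (E.cert-den n k ⊗ κ 1)) refl

  wz₄-cleared : ∀ n k → ((+ 6 ℤ.* k ℤ.+ + 1) ℤ.* + 1) ℤ.* shift-den n k ≡ wz₄ n k ℤ.* ((+ 1 ℤ.* odd n) ℤ.* + 1)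
  wz₄-cleared = solve 2 (λ n k → (κ 6 ⊗ k ⊕ κ 1) ⊗ κ 1 ⊗ E.shift-den n k
                               ⊜ E.wz₄ n k ⊗ (κ 1 ⊗ E.odd n ⊗ κ 1)) refl

  wz-balance : ∀ n k → wz₁ n k ℤ.+ wz₄ n k ≡ wz₂ n k ℤ.- wz₃ n k
  wz-balance = solve 2 (λ n k → (E.wz₁ n k ⊕ E.wz₄ n k) ⊜ (E.wz₂ n k ⊕ ⊝ E.wz₃ n k)) refl

  -- Multiplying by shift-num n k turns ∏β n k into ∏β (n+2) k and leaves polynomial identities.
  wz-step : ∀ n k → F (n ℕ.+ 2) k * ((+ 1) ÷ odd (+ (n ℕ.+ 2))) + F n k * ((+ 1) ÷ odd (+ n)) ≡ G n (suc k) - G n k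
  wz-step n k = *-cancelʳ-ι (shift-num-≢0 n k) (begin
    ((s * d₂) * a + (s * d₀) * b) * c₂             ≡⟨ regroupˡ s d₂ a d₀ b c₂ ⟩
    d₂ * ((s * a) * c₂) + (s * b) * (c₂ * d₀)      ≡⟨ cong₂ (λ x y → d₂ * x + (s * b) * y) e₁ (sym (∏β-shift n k)) ⟩
    d₂ * ι (wz₁ N K) + (s * b) * (c₁ * d₂)         ≡⟨ regroupᵐ d₂ (ι (wz₁ N K)) (s * b) c₁ ⟩
    d₂ * (ι (wz₁ N K) + (s * b) * c₁)              ≡⟨ cong (λ x → d₂ * (ι (wz₁ N K) + x)) e₄ ⟩
    d₂ * (ι (wz₁ N K) + ι (wz₄ N K))               ≡⟨ cong (d₂ *_) balance ⟩
    d₂ * (ι (wz₂ N K) - ι (wz₃ N K))               ≡⟨ cong₂ (λ x y → d₂ * (x - y)) e₂ e₃ ⟨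
    d₂ * ((g′ * β₂) * c₂ - g * c₂)                 ≡⟨ regroupʳ g′ d₂ β₂ g c₂ ⟩
    (g′ * (d₂ * β₂) - g * d₂) * c₂                 ≡⟨ cong (λ z → (cert z * (d₂ * β₂) - g * d₂) * c₂) (+suc k) ⟨
    (G n (suc k) - G n k) * c₂                     ∎)
    where
    open ≡-Reasoning
    N = + n
    K = + k
    N₂ = + (n ℕ.+ 2)
    K′ = K ℤ.+ + 1
    cert : ℤ → ℚ
    cert z = cert-num N z ÷ cert-den N z
    s = ι (+ 6 ℤ.* K ℤ.+ + 1)
    a = (+ 1) ÷ odd N₂
    b = (+ 1) ÷ odd N
    d₀ = ∏β n k
    d₂ = ∏β (n ℕ.+ 2) k
    β₂ = β (n ℕ.+ 2) k
    g = cert K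
    g′ = cert K′
    c₁ = ι (shift-den N K)
    c₂ = ι (shift-num N K)
    e₁ : (s * a) * c₂ ≡ ι (wz₁ N K)
    e₁ = fraction-≡ι (fraction-* (fraction-* (fraction-ι (+ 6 ℤ.* K ℤ.+ + 1)) (fraction-÷ (+ 1) (odd-≢0 N₂)))
                                 (fraction-ι (shift-num N K)))
                     (wz₁ N K) (wz₁-cleared N K)
    e₂ : (g′ * β₂) * c₂ ≡ ι (wz₂ N K)
    e₂ = fraction-≡ι (fraction-* (fraction-* (fraction-÷ (cert-num N K′) (cert-den-≢0 n (k ℕ.+ 1)))
                                             (fraction-÷ (β-num N₂ K) (β-den-≢0 (n ℕ.+ 2) k)))
                                 (fraction-ι (shift-num N K)))
                     (wz₂ N K) (wz₂-cleared N K)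
    e₃ : g * c₂ ≡ ι (wz₃ N K)
    e₃ = fraction-≡ι (fraction-* (fraction-÷ (cert-num N K) (cert-den-≢0 n k)) (fraction-ι (shift-num N K)))
                     (wz₃ N K) (wz₃-cleared N K)
    e₄ : (s * b) * c₁ ≡ ι (wz₄ N K)
    e₄ = fraction-≡ι (fraction-* (fraction-* (fraction-ι (+ 6 ℤ.* K ℤ.+ + 1)) (fraction-÷ (+ 1) (odd-≢0 N)))
                                 (fraction-ι (shift-den N K)))
                     (wz₄ N K) (wz₄-cleared N K)
    balance : ι (wz₁ N K) + ι (wz₄ N K) ≡ ι (wz₂ N K) - ι (wz₃ N K)
    balance = begin
      ι (wz₁ N K) + ι (wz₄ N K)          ≡⟨ ι-homo-+ (wz₁ N K) (wz₄ N K) ⟨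
      ι (wz₁ N K ℤ.+ wz₄ N K)            ≡⟨ cong ι (wz-balance N K) ⟩
      ι (wz₂ N K ℤ.- wz₃ N K)            ≡⟨ ι-homo-+ (wz₂ N K) (ℤ.- wz₃ N K) ⟩
      ι (wz₂ N K) + ι (ℤ.- wz₃ N K)      ≡⟨ cong (λ x → ι (wz₂ N K) + x) (ι-homo‿- (wz₃ N K)) ⟩
      ι (wz₂ N K) - ι (wz₃ N K)          ∎
    regroupˡ : ∀ s d₂ a d₀ b c₂ → ((s * d₂) * a + (s * d₀) * b) * c₂ ≡ d₂ * ((s * a) * c₂) + (s * b) * (c₂ * d₀)
    regroupˡ = ℚ-Solver.solve-∀ ℚ-ring
    regroupᵐ : ∀ d₂ w sb c₁ → d₂ * w + sb * (c₁ * d₂) ≡ d₂ * (w + sb * c₁)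
    regroupᵐ = ℚ-Solver.solve-∀ ℚ-ring
    regroupʳ : ∀ g′ d₂ β₂ g c₂ → d₂ * ((g′ * β₂) * c₂ - g * c₂) ≡ (g′ * (d₂ * β₂) - g * d₂) * c₂
    regroupʳ = ℚ-Solver.solve-∀ ℚ-ring

  ∏β-vanishes : ∀ n k → n < k → ∏β n k ≡ 0ℚ
  ∏β-vanishes n (suc k) n<1+k with ℕP.m<1+n⇒m<n∨m≡n n<1+k
  ... | inj₁ n<k  = trans (cong (_* β n k) (∏β-vanishes n k n<k)) (ℚP.*-zeroˡ (β n k))
  ... | inj₂ refl = trans (cong (λ z → ∏β n n * (ι z * ι⁻¹ (β-den (+ n) (+ n)))) (β-num-diag (+ n)))
                          (trans (cong (∏β n n *_) (ℚP.*-zeroˡ (ι⁻¹ (β-den (+ n) (+ n))))) (ℚP.*-zeroʳ (∏β n n)))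
    where
    β-num-diag : ∀ n → β-num n n ≡ + 0
    β-num-diag = solve 1 (λ n → E.β-num n n ⊜ κ 0) refl

  S : ℕ → ℚ
  S n = sumTo n (F n)

  F-vanishes : ∀ n k → n < k → F n k ≡ 0ℚ
  F-vanishes n k n<k = trans (cong (s *_) (∏β-vanishes n k n<k)) (ℚP.*-zeroʳ s)
    where s = ι (+ 6 ℤ.* + k ℤ.+ + 1)

  G-vanishes : ∀ n k → n ℕ.+ 2 < k → G n k ≡ 0ℚ
  G-vanishes n k n+2<k = trans (cong (cert *_) (∏β-vanishes (n ℕ.+ 2) k n+2<k)) (ℚP.*-zeroʳ cert)
    where cert = cert-num (+ n) (+ k) ÷ cert-den (+ n) (+ k)

  G-at-0 : ∀ n → G n 0 ≡ 0ℚ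
  G-at-0 n = trans (cong (λ z → ι z * ι⁻¹ (cert-den (+ n) (+ 0)) * 1ℚ) (cert-num-at-0 (+ n)))
                   (trans (ℚP.*-identityʳ _) (ℚP.*-zeroˡ (ι⁻¹ (cert-den (+ n) (+ 0)))))
    where
    cert-num-at-0 : ∀ n → cert-num n (+ 0) ≡ + 0
    cert-num-at-0 = solve 1 (λ n → E.cert-num n (κ 0) ⊜ κ 0) refl

  recurrence : ∀ n → S (n ℕ.+ 2) * ((+ 1) ÷ odd (+ (n ℕ.+ 2))) + S n * ((+ 1) ÷ odd (+ n)) ≡ 0ℚ
  recurrence n = begin
    S n₂ * a + S n * b                           ≡⟨ cong (λ x → S n₂ * a + x * b) S-padded ⟨
    S n₂ * a + sumTo n₂ (F n) * b                ≡⟨ cong₂ _+_ (sumTo-*ʳ n₂ (F n₂) a) (sumTo-*ʳ n₂ (F n) b) ⟨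
    sumTo n₂ (λ k → F n₂ k * a) + sumTo n₂ (λ k → F n k * b)
                                                 ≡⟨ sumTo-+ n₂ (λ k → F n₂ k * a) (λ k → F n k * b) ⟨
    sumTo n₂ (λ k → F n₂ k * a + F n k * b)      ≡⟨ sumTo-telescope {g = G n} (wz-step n) n₂ ⟩
    G n (suc n₂) - G n 0                         ≡⟨ cong₂ _-_ (G-vanishes n (suc n₂) (ℕP.n<1+n n₂)) (G-at-0 n) ⟩
    0ℚ - 0ℚ                                      ≡⟨⟩
    0ℚ                                           ∎
    where
    open ≡-Reasoning
    n₂ = n ℕ.+ 2
    a = (+ 1) ÷ odd (+ n₂)
    b = (+ 1) ÷ odd (+ n)
    S-padded : sumTo n₂ (F n) ≡ S n
    S-padded rewrite ℕP.+-comm n 2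
      | F-vanishes n (suc n) (ℕP.n<1+n n) | F-vanishes n (suc (suc n)) (ℕP.m<n⇒m<1+n (ℕP.n<1+n n))
      = trans (ℚP.+-identityʳ _) (ℚP.+-identityʳ _)

  triangle : ℕ → ℕ
  triangle zero    = 0
  triangle (suc n) = triangle n ℕ.+ suc n

  sgn-suc : ∀ a → sgn (suc a) ≡ - sgn a
  sgn-suc a = times-minus-one (sgn a)
    where
    times-minus-one : ∀ x → x * (- 1ℚ) ≡ - x
    times-minus-one = ℚ-Solver.solve-∀ ℚ-ring

  sgn-+ : ∀ a b → sgn (a ℕ.+ b) ≡ sgn a * sgn b
  sgn-+ zero    b = sym (ℚP.*-identityˡ (sgn b))
  sgn-+ (suc a) b = begin
    sgn (suc a ℕ.+ b)        ≡⟨ sgn-suc (a ℕ.+ b) ⟩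
    - sgn (a ℕ.+ b)          ≡⟨ cong -_ (sgn-+ a b) ⟩
    - (sgn a * sgn b)        ≡⟨ ℚP.neg-distribˡ-* (sgn a) (sgn b) ⟩
    - sgn a * sgn b          ≡⟨ cong (_* sgn b) (sgn-suc a) ⟨
    sgn (suc a) * sgn b      ∎
    where open ≡-Reasoning

  sgn-double : ∀ m → sgn (m ℕ.+ m) ≡ 1ℚ
  sgn-double zero    = refl
  sgn-double (suc m) = begin
    sgn (suc m ℕ.+ suc m)        ≡⟨ cong sgn (ℕP.+-suc (suc m) m) ⟩
    sgn (suc (suc (m ℕ.+ m)))    ≡⟨ sgn-suc (suc (m ℕ.+ m)) ⟩
    - sgn (suc (m ℕ.+ m))        ≡⟨ cong -_ (sgn-suc (m ℕ.+ m)) ⟩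
    - - sgn (m ℕ.+ m)            ≡⟨ neg-involutive (sgn (m ℕ.+ m)) ⟩
    sgn (m ℕ.+ m)                ≡⟨ sgn-double m ⟩
    1ℚ                           ∎
    where open ≡-Reasoning

  sign-step : ∀ n → sgn (triangle (suc (suc n)) ℕ.+ suc (suc n)) ≡ - sgn (triangle n ℕ.+ n)
  sign-step n = begin
    sgn (triangle (suc (suc n)) ℕ.+ suc (suc n))   ≡⟨ cong sgn (exponent (triangle n) n) ⟩
    sgn (suc (e ℕ.+ (m ℕ.+ m)))                    ≡⟨ sgn-suc (e ℕ.+ (m ℕ.+ m)) ⟩
    - sgn (e ℕ.+ (m ℕ.+ m))                        ≡⟨ cong -_ (sgn-+ e (m ℕ.+ m)) ⟩
    - (sgn e * sgn (m ℕ.+ m))                      ≡⟨ cong (λ x → - (sgn e * x)) (sgn-double m) ⟩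
    - (sgn e * 1ℚ)                                 ≡⟨ cong -_ (ℚP.*-identityʳ (sgn e)) ⟩
    - sgn e                                        ∎
    where
    open ≡-Reasoning
    e = triangle n ℕ.+ n
    m = suc (suc n)
    exponent : ∀ t n → t ℕ.+ suc n ℕ.+ suc (suc n) ℕ.+ suc (suc n) ≡ suc (t ℕ.+ n ℕ.+ (suc (suc n) ℕ.+ suc (suc n)))
    exponent = ℕ-Solver.solve-∀

  ÷-inverseˡ : ∀ {d} → d ≢ + 0 → ((+ 1) ÷ d) * ι d ≡ 1ℚ
  ÷-inverseˡ d≢0 = cleared (fraction-÷ (+ 1) d≢0)

  S-exact : ∀ n → S n ≡ sgn (triangle n ℕ.+ n) * ι (odd (+ n))
  S-exact zero          = refl
  S-exact (suc zero)    = refl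
  S-exact (suc (suc n)) = begin
    S (suc (suc n))                               ≡⟨ cong S (ℕP.+-comm 2 n) ⟩
    S₂                                            ≡⟨ ℚP.*-identityʳ S₂ ⟨
    S₂ * 1ℚ                                       ≡⟨ cong (S₂ *_) (÷-inverseˡ (odd-≢0 N₂)) ⟨
    S₂ * (a * ι (odd N₂))                         ≡⟨ ℚP.*-assoc S₂ a (ι (odd N₂)) ⟨
    (S₂ * a) * ι (odd N₂)                         ≡⟨ cong (_* ι (odd N₂)) (+-inverseˡ-unique (S₂ * a) (S n * b) (recurrence n)) ⟩
    (- (S n * b)) * ι (odd N₂)                    ≡⟨ cong (λ x → (- (x * b)) * ι (odd N₂)) (S-exact n) ⟩
    (- ((sgn e * ι (odd N)) * b)) * ι (odd N₂)    ≡⟨ regroup (sgn e) (ι (odd N)) b (ι (odd N₂)) ⟩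
    (- sgn e) * (b * ι (odd N)) * ι (odd N₂)      ≡⟨ cong (λ x → (- sgn e) * x * ι (odd N₂)) (÷-inverseˡ (odd-≢0 N)) ⟩
    (- sgn e) * 1ℚ * ι (odd N₂)                   ≡⟨ cong (_* ι (odd N₂)) (ℚP.*-identityʳ (- sgn e)) ⟩
    (- sgn e) * ι (odd N₂)                        ≡⟨ cong₂ (λ x y → x * ι (odd (+ y))) (sym (sign-step n)) (ℕP.+-comm n 2) ⟩
    sgn (triangle (suc (suc n)) ℕ.+ suc (suc n)) * ι (odd (+ suc (suc n)))  ∎
    where
    open ≡-Reasoning
    N = + n
    N₂ = + (n ℕ.+ 2)
    S₂ = S (n ℕ.+ 2)
    a = (+ 1) ÷ odd N₂
    b = (+ 1) ÷ odd N
    e = triangle n ℕ.+ n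
    regroup : ∀ σ o b o₂ → (- ((σ * o) * b)) * o₂ ≡ (- σ) * (b * o) * o₂
    regroup = ℚ-Solver.solve-∀ ℚ-ring

  -- The coefficients ((1/2)_k/k!)³(-1/8)^k

  inv-cleared : ∀ n .{{_ : NonZero n}} → inv n * ι (+ n) ≡ 1ℚ
  inv-cleared (suc m) = ℚP.toℚᵘ-injective (begin
    ℚ.toℚᵘ (inv (suc m) * ι (+ suc m))                      ≈⟨ ℚP.toℚᵘ-homo-* (inv (suc m)) (ι (+ suc m)) ⟩
    ℚ.toℚᵘ (inv (suc m)) ℚᵘ.* ℚ.toℚᵘ (ι (+ suc m))          ≈⟨ ℚᵘP.*-cong (ℚP.toℚᵘ-fromℚᵘ (ℚᵘ.mkℚᵘ (+ 1) m)) (ι-toℚᵘ (+ suc m)) ⟩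
    ℚᵘ.mkℚᵘ (+ 1) m ℚᵘ.* ℚᵘ.mkℚᵘ (+ suc m) 0               ≈⟨ ℚᵘ.*≡* cross ⟩
    ℚᵘ.1ℚᵘ                                                  ∎)
    where
    open ℚᵘP.≃-Reasoning
    cross : (+ 1 ℤ.* + suc m) ℤ.* + 1 ≡ + 1 ℤ.* + (suc m ℕ.* 1)
    cross = trans (ℤP.*-identityʳ _) (cong (λ x → + 1 ℤ.* + x) (sym (ℕP.*-identityʳ (suc m))))

  inv-*-cancel : ∀ a b .{{_ : NonZero a}} .{{_ : NonZero b}} → inv (a ℕ.* b) {{ℕP.m*n≢0 a b}} * ι (+ a) ≡ inv b
  inv-*-cancel a b = *-cancelʳ-ι {d = + b} (λ b≡0 → ℕ.≢-nonZero⁻¹ b (ℤP.+-injective b≡0)) (begin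
    (inv (a ℕ.* b) {{ℕP.m*n≢0 a b}} * ι (+ a)) * ι (+ b)   ≡⟨ ℚP.*-assoc (inv (a ℕ.* b) {{ℕP.m*n≢0 a b}}) (ι (+ a)) (ι (+ b)) ⟩
    inv (a ℕ.* b) {{ℕP.m*n≢0 a b}} * (ι (+ a) * ι (+ b))   ≡⟨ cong (inv (a ℕ.* b) {{ℕP.m*n≢0 a b}} *_) ι-pos-* ⟨
    inv (a ℕ.* b) {{ℕP.m*n≢0 a b}} * ι (+ (a ℕ.* b))       ≡⟨ inv-cleared (a ℕ.* b) {{ℕP.m*n≢0 a b}} ⟩
    1ℚ                                                     ≡⟨ inv-cleared b ⟨
    inv b * ι (+ b)                                        ∎)
    where
    open ≡-Reasoning
    ι-pos-* : ι (+ (a ℕ.* b)) ≡ ι (+ a) * ι (+ b)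
    ι-pos-* = trans (cong ι (ℤP.pos-* a b)) (ι-homo-* (+ a) (+ b))

  ½ₖ/k! : ℕ → ℚ
  ½ₖ/k! k = rising ½ k * inv (k !) {{k !≢0}}

  coeff : ℕ → ℚ
  coeff k = pow (½ₖ/k! k) 3 * sgn k * inv (8 ℕ.^ k) {{m^n≢0 8 k}}

  summand≡coeff : ∀ k → summand k ≡ ι (+ 6 ℤ.* + k ℤ.+ + 1) * coeff k
  summand≡coeff k = trans (reassoc (ι (+ (6 ℕ.* k ℕ.+ 1))) _ _ _) (cong (λ z → ι (z ℤ.+ + 1) * coeff k) (ℤP.pos-* 6 k))
    where
    reassoc : ∀ x a b e → ((x * a) * b) * e ≡ x * ((a * b) * e)
    reassoc = ℚ-Solver.solve-∀ ℚ-ring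

  α : ℕ → ℚ
  α k = α-num (+ k) ÷ α-den (+ k)

  ½+k-cleared : ∀ k → (½ + ι (+ k)) * ι (+ 2) ≡ ι (odd (+ k))
  ½+k-cleared k = begin
    (½ + ι (+ k)) * ι (+ 2)               ≡⟨ ℚP.*-distribʳ-+ (ι (+ 2)) ½ (ι (+ k)) ⟩
    ½ * ι (+ 2) + ι (+ k) * ι (+ 2)       ≡⟨ ℚP.+-comm 1ℚ (ι (+ k) * ι (+ 2)) ⟩
    ι (+ k) * ι (+ 2) + ι (+ 1)           ≡⟨ cong (_+ ι (+ 1)) (ℚP.*-comm (ι (+ k)) (ι (+ 2))) ⟩
    ι (+ 2) * ι (+ k) + ι (+ 1)           ≡⟨ cong (_+ ι (+ 1)) (ι-homo-* (+ 2) (+ k)) ⟨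
    ι (+ 2 ℤ.* + k) + ι (+ 1)             ≡⟨ ι-homo-+ (+ 2 ℤ.* + k) (+ 1) ⟨
    ι (odd (+ k))                         ∎
    where open ≡-Reasoning

  ½ₖ/k!-step : ∀ k → ½ₖ/k! (suc k) * ι (+ 2 ℤ.* (+ k ℤ.+ + 1)) ≡ ½ₖ/k! k * ι (odd (+ k))
  ½ₖ/k!-step k = begin
    (r * h * i′) * ι (+ 2 ℤ.* (+ k ℤ.+ + 1))       ≡⟨ cong (λ z → (r * h * i′) * ι (+ 2 ℤ.* z)) (+suc k) ⟨
    (r * h * i′) * ι (+ 2 ℤ.* + suc k)             ≡⟨ cong ((r * h * i′) *_) (ι-homo-* (+ 2) (+ suc k)) ⟩
    (r * h * i′) * (ι (+ 2) * ι (+ suc k))         ≡⟨ regroup r h i′ (ι (+ 2)) (ι (+ suc k)) ⟩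
    r * (h * ι (+ 2)) * (i′ * ι (+ suc k))         ≡⟨ cong₂ (λ u v → r * u * v) (½+k-cleared k) (inv-*-cancel (suc k) (k !) {{_}} {{k !≢0}}) ⟩
    r * ι (odd (+ k)) * inv (k !) {{k !≢0}}        ≡⟨ swap r (ι (odd (+ k))) (inv (k !) {{k !≢0}}) ⟩
    ½ₖ/k! k * ι (odd (+ k))                        ∎
    where
    open ≡-Reasoning
    r = rising ½ k
    h = ½ + ι (+ k)
    i′ = inv (suc k !) {{suc k !≢0}}
    regroup : ∀ r h i′ t s → (r * h * i′) * (t * s) ≡ r * (h * t) * (i′ * s)
    regroup = ℚ-Solver.solve-∀ ℚ-ring
    swap : ∀ r o i → r * o * i ≡ (r * i) * o
    swap = ℚ-Solver.solve-∀ ℚ-ring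

  coeff-step : ∀ k → coeff (suc k) ≡ coeff k * α k
  coeff-step k = *-cancelʳ-ι (α-den-≢0 k) (begin
    coeff (suc k) * ι (α-den K)                                      ≡⟨ cong (coeff (suc k) *_) ι-α-den ⟩
    coeff (suc k) * (ι (+ 8) * (y * y * y))                          ≡⟨ regroup₁ (½ₖ/k! (suc k)) y (sgn k) e′ (ι (+ 8)) ⟩
    pow (½ₖ/k! (suc k) * y) 3 * (sgn k * - 1ℚ) * (e′ * ι (+ 8))  ≡⟨ cong₂ (λ u v → pow u 3 * (sgn k * - 1ℚ) * v)
                                                                           (½ₖ/k!-step k) (inv-*-cancel 8 (8 ℕ.^ k) {{_}} {{m^n≢0 8 k}}) ⟩
    pow (½ₖ/k! k * o) 3 * (sgn k * - 1ℚ) * e                     ≡⟨ regroup₂ (½ₖ/k! k) o (sgn k) e ⟩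
    coeff k * - (o * o * o)                                          ≡⟨ cong (coeff k *_) ι-α-num ⟨
    coeff k * ι (α-num K)                                            ≡⟨ cong (coeff k *_) (cleared (fraction-÷ (α-num K) (α-den-≢0 k))) ⟨
    coeff k * (α k * ι (α-den K))                                    ≡⟨ ℚP.*-assoc (coeff k) (α k) (ι (α-den K)) ⟨
    coeff k * α k * ι (α-den K)                                      ∎)
    where
    open ≡-Reasoning
    K = + k
    t = + 2 ℤ.* (K ℤ.+ + 1)
    y = ι t
    o = ι (odd K)
    e = inv (8 ℕ.^ k) {{m^n≢0 8 k}}
    e′ = inv (8 ℕ.^ suc k) {{m^n≢0 8 (suc k)}}
    α-den-cube : ∀ k → α-den k ≡ + 8 ℤ.* (+ 2 ℤ.* (k ℤ.+ + 1) ℤ.* (+ 2 ℤ.* (k ℤ.+ + 1)) ℤ.* (+ 2 ℤ.* (k ℤ.+ + 1)))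
    α-den-cube = solve 1 (λ k → E.α-den k ⊜ (κ 8 ⊗ (κ 2 ⊗ (k ⊕ κ 1) ⊗ (κ 2 ⊗ (k ⊕ κ 1)) ⊗ (κ 2 ⊗ (k ⊕ κ 1))))) refl
    ι-α-den : ι (α-den K) ≡ ι (+ 8) * (y * y * y)
    ι-α-den = begin
      ι (α-den K)                      ≡⟨ cong ι (α-den-cube K) ⟩
      ι (+ 8 ℤ.* (t ℤ.* t ℤ.* t))      ≡⟨ ι-homo-* (+ 8) (t ℤ.* t ℤ.* t) ⟩
      ι (+ 8) * ι (t ℤ.* t ℤ.* t)      ≡⟨ cong (ι (+ 8) *_) (trans (ι-homo-* (t ℤ.* t) t) (cong (_* y) (ι-homo-* t t))) ⟩
      ι (+ 8) * (y * y * y)            ∎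
    ι-α-num : ι (α-num K) ≡ - (o * o * o)
    ι-α-num = trans (ι-homo‿- (odd K ℤ.* odd K ℤ.* odd K))
                    (cong -_ (trans (ι-homo-* (odd K ℤ.* odd K) (odd K)) (cong (_* o) (ι-homo-* (odd K) (odd K)))))
    regroup₁ : ∀ x y s e′ i₈ → 1ℚ * x * x * x * (s * - 1ℚ) * e′ * (i₈ * (y * y * y))
                           ≡ 1ℚ * (x * y) * (x * y) * (x * y) * (s * - 1ℚ) * (e′ * i₈)
    regroup₁ = ℚ-Solver.solve-∀ ℚ-ring
    regroup₂ : ∀ x o s e → 1ℚ * (x * o) * (x * o) * (x * o) * (s * - 1ℚ) * e ≡ 1ℚ * x * x * x * s * e * - (o * o * o)
    regroup₂ = ℚ-Solver.solve-∀ ℚ-ring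

  -- Comparison modulo p²

  α-β-cleared : ∀ n k → α-num k ℤ.* β-den n k ℤ.+ (ℤ.- β-num n k) ℤ.* α-den k
    ≡ (odd k ℤ.* (k ℤ.+ + 1) ℤ.* (odd k ℤ.* odd k ℤ.- + 16 ℤ.* ((k ℤ.+ + 1) ℤ.* (k ℤ.+ + 1)))) ℤ.* (odd n ℤ.* odd n)
  α-β-cleared = solve 2 (λ n k → (E.α-num k ⊗ E.β-den n k ⊕ (⊝ E.β-num n k) ⊗ E.α-den k)
                               ⊜ (E.odd k ⊗ (k ⊕ κ 1) ⊗ (E.odd k ⊗ E.odd k ⊕ ⊝ (κ 16 ⊗ ((k ⊕ κ 1) ⊗ (k ⊕ κ 1))))
                                  ⊗ (E.odd n ⊗ E.odd n))) refl

  module _ {p n : ℕ} (p-prime : Prime p) (p≡2n+1 : p ≡ suc (n ℕ.* 2)) (p>3 : 3 < p) where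

    +p≡odd : + p ≡ odd (+ n)
    +p≡odd = trans (cong +_ p≡2n+1) (trans (cong (λ z → + 1 ℤ.+ z) (ℤP.pos-* n 2)) (swap (+ n)))
      where
      swap : ∀ n → + 1 ℤ.+ n ℤ.* + 2 ≡ odd n
      swap = solve 1 (λ n → (κ 1 ⊕ n ⊗ κ 2) ⊜ E.odd n) refl

    ∤2^ : ∀ m → ¬ (p ∣ 2 ^ m)
    ∤2^ zero    = ∤-1 p-prime
    ∤2^ (suc m) = ∤-* p-prime p∤2 (∤2^ m)
      where
      p∤2 : ¬ (p ∣ 2)
      p∤2 p∣2 = ℕP.<-asym (s≤s (ℕD.∣⇒≤ p∣2)) p>3

    ∤k+1 : ∀ k → k < n → ¬ (p ∣ k ℕ.+ 1)
    ∤k+1 k k<n p∣k+1 = ℕP.<-irrefl refl (begin-strict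
      p          ≤⟨ ℕD.∣⇒≤ (subst (p ∣_) (ℕP.+-comm k 1) p∣k+1) ⟩
      suc k      ≤⟨ k<n ⟩
      n          <⟨ s≤s (ℕP.m≤m*n n 2) ⟩
      suc (n ℕ.* 2)  ≡⟨ p≡2n+1 ⟨
      p          ∎)
      where open ℕP.≤-Reasoning

    ∤-abs-+p* : ∀ x y {m} → x ℤ.+ + p ℤ.* y ≡ + m → ¬ (p ∣ m) → ¬ (p ∣ ℤ.∣ x ∣)
    ∤-abs-+p* x y {m} x+py≡m p∤m p∣x = p∤m (ℤS.∣⇒∣ᵤ {+ p} {+ m} (subst (+ p ℤS.∣_) x+py≡m
      (ℤS.∣m∣n⇒∣m+n (ℤS.∣ᵤ⇒∣ {+ p} {x} p∣x) (ℤS.∣m⇒∣m*n y (ℤS.∣-refl {+ p})))))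

    ∤α-den : ∀ k → k < n → ¬ (p ∣ ℤ.∣ α-den (+ k) ∣)
    ∤α-den k k<n = ∤-abs-* p-prime (+ 64) (K+1 ℤ.* K+1 ℤ.* K+1) (∤2^ 6)
      (∤-abs-* p-prime (K+1 ℤ.* K+1) K+1 (∤-abs-* p-prime K+1 K+1 p∤k+1 p∤k+1) p∤k+1)
      where
      K+1 = + k ℤ.+ + 1
      p∤k+1 : ¬ (p ∣ k ℕ.+ 1)
      p∤k+1 = ∤k+1 k k<n

    ∤β-den : ∀ k → k < n → ¬ (p ∣ ℤ.∣ β-den (+ n) (+ k) ∣)
    ∤β-den k k<n = ∤-abs-* p-prime (+ k ℤ.+ + 1) _ (∤k+1 k k<n)
      (∤-abs-* p-prime left right (∤-abs-+p* left (+ 1) (via-odd left (+ 1) (left-eq N K)) p∤4[k+1])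
                               (∤-abs-+p* right (ℤ.- + 1) (via-odd right (ℤ.- + 1) (right-eq N K)) p∤4[k+1]))
      where
      N = + n
      K = + k
      left = odd (+ 2 ℤ.* K ℤ.+ + 1 ℤ.- N)
      right = odd (+ 2 ℤ.* K ℤ.+ + 2 ℤ.+ N)
      p∤4[k+1] : ¬ (p ∣ 4 ℕ.* (k ℕ.+ 1))
      p∤4[k+1] = ∤-* p-prime (∤2^ 2) (∤k+1 k k<n)
      left-eq : ∀ n k → odd (+ 2 ℤ.* k ℤ.+ + 1 ℤ.- n) ℤ.+ odd n ℤ.* + 1 ≡ + 4 ℤ.* (k ℤ.+ + 1)
      left-eq = solve 2 (λ n k → (E.odd (κ 2 ⊗ k ⊕ κ 1 ⊕ ⊝ n) ⊕ E.odd n ⊗ κ 1) ⊜ κ 4 ⊗ (k ⊕ κ 1)) refl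
      right-eq : ∀ n k → odd (+ 2 ℤ.* k ℤ.+ + 2 ℤ.+ n) ℤ.+ odd n ℤ.* (ℤ.- + 1) ≡ + 4 ℤ.* (k ℤ.+ + 1)
      right-eq = solve 2 (λ n k → (E.odd (κ 2 ⊗ k ⊕ κ 2 ⊕ n) ⊕ E.odd n ⊗ (⊝ κ 1)) ⊜ κ 4 ⊗ (k ⊕ κ 1)) refl
      via-odd : ∀ x y → x ℤ.+ odd N ℤ.* y ≡ + 4 ℤ.* (K ℤ.+ + 1) → x ℤ.+ + p ℤ.* y ≡ + (4 ℕ.* (k ℕ.+ 1))
      via-odd x y eq = trans (cong (λ z → x ℤ.+ z ℤ.* y) +p≡odd) (trans eq (sym (ℤP.pos-* 4 (k ℕ.+ 1))))

    α≡β : ∀ k → k < n → p ^ 2 ∣ℚ (α k - β n k)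
    α≡β k k<n = ∣ℚ-fraction p-prime 2
      (fraction-- (fraction-÷ (α-num K) (α-den-≢0 k)) (fraction-÷ (β-num N K) (β-den-≢0 n k)))
      (∤-abs-* p-prime (α-den K) (β-den N K) (∤α-den k k<n) (∤β-den k k<n))
      (ℤS.∣⇒∣ᵤ {+ (p ^ 2)} (ℤS.divides cofactor (trans (α-β-cleared N K) (cong (cofactor ℤ.*_) odd²≡p²))))
      where
      N = + n
      K = + k
      cofactor = odd K ℤ.* (K ℤ.+ + 1) ℤ.* (odd K ℤ.* odd K ℤ.- + 16 ℤ.* ((K ℤ.+ + 1) ℤ.* (K ℤ.+ + 1)))
      odd²≡p² : odd N ℤ.* odd N ≡ + (p ^ 2)
      odd²≡p² = begin
        odd N ℤ.* odd N      ≡⟨ cong₂ ℤ._*_ +p≡odd +p≡odd ⟨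
        + p ℤ.* + p          ≡⟨ ℤP.pos-* p p ⟨
        + (p ℕ.* p)          ≡⟨ cong (λ z → + (p ℕ.* z)) (ℕP.*-identityʳ p) ⟨
        + (p ^ 2)            ∎
        where open ≡-Reasoning

    coeff≡∏β : ∀ k → k ≤ n → p ^ 0 ∣ℚ ∏β n k × p ^ 2 ∣ℚ (coeff k - ∏β n k)
    coeff≡∏β zero    _       = ∣ℚ-ι p-prime (+ 1) , ∣ℚ-0ℚ p-prime
    coeff≡∏β (suc k) k<n with coeff≡∏β k (ℕP.<⇒≤ k<n)
    ... | ∏β-integral , coeff≡∏βₖ =
      ∣ℚ-* p-prime ∏β-integral (∣ℚ-÷ p-prime (β-num (+ n) (+ k)) (β-den-≢0 n k) (∤β-den k k<n)) ,
      subst (p ^ 2 ∣ℚ_) (sym difference)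
        (∣ℚ-+ p-prime (∣ℚ-* p-prime coeff≡∏βₖ (∣ℚ-÷ p-prime (α-num (+ k)) (α-den-≢0 k) (∤α-den k k<n)))
                      (∣ℚ-* p-prime ∏β-integral (α≡β k k<n)))
      where
      difference : coeff (suc k) - ∏β n (suc k) ≡ (coeff k - ∏β n k) * α k + ∏β n k * (α k - β n k)
      difference = trans (cong (_- ∏β n (suc k)) (coeff-step k)) (split (coeff k) (∏β n k) (α k) (β n k))
        where
        split : ∀ c d a b → c * a - d * b ≡ (c - d) * a + d * (a - b)
        split = ℚ-Solver.solve-∀ ℚ-ring

    summand≡F : ∀ k → k ≤ n → p ^ 2 ∣ℚ (summand k - F n k)
    summand≡F k k≤n = subst (p ^ 2 ∣ℚ_) (sym difference)
      (∣ℚ-* p-prime (∣ℚ-ι p-prime (+ 6 ℤ.* + k ℤ.+ + 1)) (proj₂ (coeff≡∏β k k≤n)))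
      where
      s = ι (+ 6 ℤ.* + k ℤ.+ + 1)
      difference : summand k - F n k ≡ s * (coeff k - ∏β n k)
      difference = trans (cong (_- F n k) (summand≡coeff k)) (factor s (coeff k) (∏β n k))
        where
        factor : ∀ s c d → s * c - s * d ≡ s * (c - d)
        factor = ℚ-Solver.solve-∀ ℚ-ring

    sum≡S : p ^ 2 ∣ℚ (sumTo n summand - S n)
    sum≡S = subst (p ^ 2 ∣ℚ_) (sumTo-- n summand (F n)) (∣ℚ-sumTo p-prime n _ summand≡F)

open Proof

open import Defs
open import Data.Nat using (ℕ; _>_; _∸_; _*_; _/_; _+_)
open import Data.Nat.Primality using (Prime)
open import Data.Integer using (+_)
open import Data.Rational using () renaming (_/_ to _/ℚ_)
open import Data.Rational using () renaming (_*_ to _*ℚ_)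

import Data.Nat.DivMod as ℕDM
open import Data.Nat.Primality using (prime⇒irreducible)
open import Data.Rational using () renaming (_-_ to _-ℚ_)

prime>2⇒%2≡1 : ∀ {p} → Prime p → 2 ℕ.< p → p ℕ.% 2 ≡ 1
prime>2⇒%2≡1 {p} p-prime 2<p with p ℕ.% 2 in p%2≡r | ℕDM.m%n<n p 2
... | 0 | _ with prime⇒irreducible p-prime (ℕD.m%n≡0⇒n∣m p 2 p%2≡r)
...   | inj₂ 2≡p = contradiction (subst (2 ℕ.<_) (sym 2≡p) 2<p) (ℕP.<-irrefl refl)
prime>2⇒%2≡1 p-prime 2<p | 1 | _ = refl
prime>2⇒%2≡1 p-prime 2<p | suc (suc _) | ℕ.s≤s (ℕ.s≤s ())

prime>2⇒odd : ∀ {p} → Prime p → 2 ℕ.< p → p ≡ suc ((p ∸ 1) / 2 * 2)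
prime>2⇒odd {p} p-prime 2<p = trans p≡1+2[p/2] (cong (λ m → suc (m * 2)) (sym half))
  where
  p≡1+2[p/2] : p ≡ suc (p / 2 * 2)
  p≡1+2[p/2] = trans (ℕDM.m≡m%n+[m/n]*n p 2) (cong (_+ p / 2 * 2) (prime>2⇒%2≡1 p-prime 2<p))
  half : (p ∸ 1) / 2 ≡ p / 2
  half = trans (cong (λ m → (m ∸ 1) / 2) p≡1+2[p/2]) (ℕDM.m*n/n≡m (p / 2) 2)

triangle-double : ∀ n → triangle n * 2 ≡ n * suc n
triangle-double zero    = refl
triangle-double (suc n) = begin
  (triangle n + suc n) * 2          ≡⟨ ℕP.*-distribʳ-+ 2 (triangle n) (suc n) ⟩
  triangle n * 2 + suc n * 2        ≡⟨ cong (_+ suc n * 2) (triangle-double n) ⟩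
  n * suc n + suc n * 2           ≡⟨ step n ⟩
  suc n * suc (suc n)           ∎
  where
  open ≡-Reasoning
  step : ∀ n → n * suc n + suc n * 2 ≡ suc n * suc (suc n)
  step = ℕ-Solver.solve-∀

[p²-1]/8≡triangle : ∀ {p n} → p ≡ suc (n * 2) → (p * p ∸ 1) / 8 ≡ triangle n
[p²-1]/8≡triangle {n = n} refl = trans (cong (_/ 8) p²-1≡8t) (ℕDM.m*n/n≡m (triangle n) 8)
  where
  expand : ∀ n t → t * 2 ≡ n * suc n → n * 2 + n * 2 * suc (n * 2) ≡ t * 8
  expand n t t*2≡ = trans (square n) (trans (cong (4 *_) (sym t*2≡)) (regroup t))
    where
    square : ∀ n → n * 2 + n * 2 * suc (n * 2) ≡ 4 * (n * suc n)
    square = ℕ-Solver.solve-∀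
    regroup : ∀ t → 4 * (t * 2) ≡ t * 8
    regroup = ℕ-Solver.solve-∀
  p²-1≡8t : suc (n * 2) * suc (n * 2) ∸ 1 ≡ triangle n * 8
  p²-1≡8t = expand n (triangle n) (triangle-double n)

theorem4 : (p : ℕ) → Prime p → p > 3 →
    sumTo ((p ∸ 1) / 2) summand
      ≡ sgn ((p * p ∸ 1) / 8 + (p ∸ 1) / 2) *ℚ (+ p /ℚ 1) [mod p ^ 2 ]
theorem4 p p-prime p>3 = den-coprime p²∣difference , num-divisible p²∣difference
  where
  n = (p ∸ 1) / 2
  p≡2n+1 : p ≡ suc (n * 2)
  p≡2n+1 = prime>2⇒odd p-prime (ℕP.<-trans (ℕP.n<1+n 2) p>3)
  S≡rhs : S n ≡ sgn ((p * p ∸ 1) / 8 + n) *ℚ (+ p /ℚ 1)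
  S≡rhs = trans (S-exact n)
    (cong₂ (λ e z → sgn (e + n) *ℚ ι z) (sym ([p²-1]/8≡triangle {p} {n} p≡2n+1)) (sym (+p≡odd {p} {n} p-prime p≡2n+1 p>3)))
  p²∣difference : p ^ 2 ∣ℚ (sumTo n summand -ℚ sgn ((p * p ∸ 1) / 8 + n) *ℚ (+ p /ℚ 1))
  p²∣difference = subst (λ x → p ^ 2 ∣ℚ (sumTo n summand -ℚ x)) S≡rhs (sum≡S {p} {n} p-prime p≡2n+1 p>3)
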